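{- Let $M$ be a cyclic partial multiplication matrix whose cycle has length $\ell$. For any $M$-indivisible $\pi^\#\in\mathsf{Grid}^\#(M)$ with more than one point, there exists a coil decomposition $B_1,B_2,\dots,B_m$ of $\pi^\#$, with associated sequence $v_1,\dots,v_m$, such that at least one of the following holds (where a box $B_i$ with $i>m$ is regarded as empty): (a) $|B_1|=|B_2|=\cdots=|B_\ell|=1$; (b) $|B_{\ell+1}|\ge 2$; (c) for some $1\le i\le\ell$ there exists $x\in B_i\setminus\{v_i\}$ such that $x\to v_{i+1}$ in $D_{\pi^\#}$.
   Context: A gridding matrix is a matrix with entries in $\{0,1,-1\}$ ($m$ columns, $n$ rows; $M_{ij}$ in column $i$ from the left, row $j$ from the bottom). An $M$-gridding of a permutation is a division of its plot by vertical and horizontal lines into cells, each point interior to a cell, with cell $ij$ empty if $M_{ij}=0$, increasing if $M_{ij}=1$, decreasing if $M_{ij}=-1$; $\mathsf{Grid}^\#(M)$ is the set of $M$-gridded permutations (permutations with a fixed $M$-gridding). The row-column graph $G_M$ is the bipartite graph on columns and rows with edge $ij'$ iff $M_{ij}\neq0$; $M$ is cyclic if $G_M$ is isomorphic to a cycle. A partial multiplication matrix is a gridding matrix with fixed $c_i,r_j\in\{\pm1\}$ such that $M_{ij}=c_ir_j$ whenever $M_{ij}\ne 0$; column $i$ is oriented left-to-right if $c_i=1$ and right-to-left otherwise, row $j$ bottom-to-top if $r_j=1$ and top-to-bottom otherwise. The orientation digraph $D_{\pi^\#}$ has the points as vertices and an arc $x\to y$ whenever $x,y$ share a column (resp. row)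 and $x$ precedes $y$ in its orientation; points of a cell are thus totally ordered, and the last point of a cell is the final one in this order. The $M$-sum $\sigma^\#\boxplus\tau^\#$ is the $M$-gridded permutation whose cell $ij$ contains the points of cell $ij$ of both $\sigma^\#$ and $\tau^\#$, each keeping their relative positions, with each point of $\sigma^\#$ preceding each point of $\tau^\#$ in the orientation of every column and row; $\pi^\#$ is $M$-indivisible if it is not an $M$-sum of two nonempty gridded permutations (equivalently $D_{\pi^\#}$ is strongly connected). Coil decomposition: for a non-singleton $M$-indivisible $\pi^\#$, choose $z$ to be the last point of one of the $\ell$ non-zero cells, set $B_1=\{z\}$, and for $i\ge1$ let $B_{i+1}$ be the set of points not in $B_1\cup\dots\cup B_i$ that are the head of an arc $u\to v$ of $D_{\pi^\#}$ with $u\in B_i$; let $m$ be the largest index with $B_m\neq\emptyset$. The sets $B_1,\dots,B_m$ partition the points, each $B_i$ lies in a single cell, and the non-zero cells can be labelled $1,\dots,\ell$ so that $B_i$ lies in cell $i\bmod\ell$. For each $i$, $v_i$ is the first point of $B_i$ in the order of its cell (so $v_i\to v$ for all other $v\in B_i$). Any such $B_1,\dots,B_m$ (for any choice of $z$) is a coil decomposition, with associated sequence $v_1,\dots,v_m$. -}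

module Defs where

open import Data.Nat using (ℕ; zero; suc; _≤_)
open import Data.Fin using (Fin; toℕ) renaming (_<_ to _<ᶠ_; _≤_ to _≤ᶠ_)
open import Data.Fin.Permutation using (Permutation′; _⟨$⟩ʳ_)
open import Data.Sum using (_⊎_; inj₁; inj₂)
open import Data.Product using (Σ; ∃; _×_; _,_)
open import Data.Empty using (⊥)
open import Data.Bool using (Bool; true; false)
open import Function.Bundles using (_↔_; Inverse)
open import Relation.Nullary using (¬_)
open import Relation.Binary.PropositionalEquality using (_≡_; _≢_)

data Entry : Set where
  zer pos neg : Entry

data Sign : Set where
  plus minus : Sign

_·_ : Sign → Sign → Sign
plus  · s = s
minus · plus  = minus
minus · minus = plus

toEntry : Sign → Entry
toEntry plus  = pos
toEntry minus = neg

-- a gridding matrix with m columns and n rows; M i j is the entry in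
-- column i (from the left) and row j (from the bottom)
GridMatrix : ℕ → ℕ → Set
GridMatrix m n = Fin m → Fin n → Entry

record PMM (m n : ℕ) : Set where
  field
    M    : GridMatrix m n
    c    : Fin m → Sign
    r    : Fin n → Sign
    mult : ∀ i j → M i j ≢ zer → M i j ≡ toEntry (c i · r j)

RCAdj : ∀ {m n} → GridMatrix m n → Fin m ⊎ Fin n → Fin m ⊎ Fin n → Set
RCAdj M (inj₁ i) (inj₂ j) = M i j ≢ zer
RCAdj M (inj₂ j) (inj₁ i) = M i j ≢ zer
RCAdj M (inj₁ _) (inj₁ _) = ⊥
RCAdj M (inj₂ _) (inj₂ _) = ⊥

CycSucc : (ℓ : ℕ) → Fin ℓ → Fin ℓ → Set
CycSucc ℓ a b = (suc (toℕ a) ≡ toℕ b) ⊎ ((suc (toℕ a) ≡ ℓ) × (toℕ b ≡ 0))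

CycAdj : (ℓ : ℕ) → Fin ℓ → Fin ℓ → Set
CycAdj ℓ a b = CycSucc ℓ a b ⊎ CycSucc ℓ b a

IsCyclicOfLength : ∀ {m n} → GridMatrix m n → ℕ → Set
IsCyclicOfLength {m} {n} M ℓ =
  (3 ≤ ℓ) ×
  Σ (Fin ℓ ↔ (Fin m ⊎ Fin n)) λ f →
    ∀ a b → (RCAdj M (Inverse.to f a) (Inverse.to f b) → CycAdj ℓ a b)
          × (CycAdj ℓ a b → RCAdj M (Inverse.to f a) (Inverse.to f b))

-- A gridded permutation of size N: point k (k : Fin N) is the point
-- (k , π k) of the plot; col k / row k is the column / row of the cell
-- containing it.  Grid lines are encoded by the (weakly) monotone
-- assignments of points to columns (by x-coordinate) and rows (by
-- y-coordinate); empty columns/rows are allowed.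
record Gridded {m n : ℕ} (M : GridMatrix m n) : Set where
  field
    N       : ℕ
    π       : Permutation′ N
    col     : Fin N → Fin m
    row     : Fin N → Fin n
    col-mon : ∀ a b → a ≤ᶠ b → col a ≤ᶠ col b
    row-mon : ∀ a b → (π ⟨$⟩ʳ a) ≤ᶠ (π ⟨$⟩ʳ b) → row a ≤ᶠ row b
    nonzero : ∀ a → M (col a) (row a) ≢ zer
    incr    : ∀ a b → a <ᶠ b → col a ≡ col b → row a ≡ row b →
              M (col a) (row a) ≡ pos → (π ⟨$⟩ʳ a) <ᶠ (π ⟨$⟩ʳ b)
    decr    : ∀ a b → a <ᶠ b → col a ≡ col b → row a ≡ row b →
              M (col a) (row a) ≡ neg → (π ⟨$⟩ʳ b) <ᶠ (π ⟨$⟩ʳ a)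

module _ {m n : ℕ} (P : PMM m n) (g : Gridded (PMM.M P)) where
  open PMM P
  open Gridded g

  ColPrec : Fin m → Fin N → Fin N → Set
  ColPrec i x y with c i
  ... | plus  = x <ᶠ y
  ... | minus = y <ᶠ x

  RowPrec : Fin n → Fin N → Fin N → Set
  RowPrec j x y with r j
  ... | plus  = (π ⟨$⟩ʳ x) <ᶠ (π ⟨$⟩ʳ y)
  ... | minus = (π ⟨$⟩ʳ y) <ᶠ (π ⟨$⟩ʳ x)

  Arc : Fin N → Fin N → Set
  Arc x y = ((col x ≡ col y) × ColPrec (col x) x y)
          ⊎ ((row x ≡ row y) × RowPrec (row x) x y)

  SameCell : Fin N → Fin N → Set
  SameCell x y = (col x ≡ col y) × (row x ≡ row y)

  CellPrec : Fin N → Fin N → Set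
  CellPrec x y = SameCell x y × ColPrec (col x) x y

  -- π# is an M-sum σ# ⊞ τ# of two nonempty gridded permutations:
  -- its points split into nonempty S (points of σ#) and T (points of τ#)
  -- (S given by its indicator function) such that every point of S precedes every point of T in the
  -- orientation of every column and row they share
  IsMSumOfNonempty : Set
  IsMSumOfNonempty =
    Σ (Fin N → Bool) λ S →
      (∃ λ s → S s ≡ true) × (∃ λ t → S t ≡ false) ×
      (∀ s t → S s ≡ true → S t ≡ false →
         (col s ≡ col t → ColPrec (col s) s t) ×
         (row s ≡ row t → RowPrec (row s) s t))

  Indivisible : Set
  Indivisible = ¬ IsMSumOfNonempty

  IsLastOfCell : Fin N → Set
  IsLastOfCell z = ∀ y → SameCell y z → y ≢ z → CellPrec y z

  -- Coil boxes started at z: Box z i is B_i (B_0 = ∅, B_1 = {z}),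
  -- Upto z i is B_1 ∪ ... ∪ B_i
  mutual
    Box : Fin N → ℕ → Fin N → Set
    Box z zero x = ⊥
    Box z (suc zero) x = x ≡ z
    Box z (suc (suc i)) x =
      ¬ Upto z (suc i) x × ∃ λ u → Box z (suc i) u × Arc u x

    Upto : Fin N → ℕ → Fin N → Set
    Upto z zero x = ⊥
    Upto z (suc i) x = Upto z i x ⊎ Box z (suc i) x

  BoxSingleton : Fin N → ℕ → Set
  BoxSingleton z i = ∃ λ x → Box z i x × (∀ y → Box z i y → y ≡ x)

  BoxAtLeastTwo : Fin N → ℕ → Set
  BoxAtLeastTwo z i = ∃ λ x → ∃ λ y → Box z i x × Box z i y × x ≢ y

  IsFirstOfBox : Fin N → ℕ → Fin N → Set
  IsFirstOfBox z i v = Box z i v × (∀ w → Box z i w → w ≢ v → CellPrec v w)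

{-# OPTIONS --safe #-}
module Submission where

open import Defs

open import Data.Bool using (Bool; true; false; not)
open import Data.Empty using (⊥-elim)
open import Data.Fin using (Fin; toℕ; fromℕ<; punchIn) renaming (zero to fzero)
import Data.Fin.Properties as Finₚ
open import Data.Fin.Permutation using (_⟨$⟩ʳ_)
open import Data.List using (List; []; _∷_; allFin)
open import Data.List.Membership.Propositional.Properties using (∈-allFin)
open import Data.List.Relation.Unary.All as All using (All; []; _∷_)
open import Data.Nat using (ℕ; zero; suc; _+_; _*_; _∸_; _≤_; _<_; z≤n; s≤s; NonZero)
open import Data.Nat.DivMod
  using (_%_; _/_; m≡m%n+[m/n]*n; %-distribˡ-+; m%n%n≡m%n; m%n<n; m<n⇒m%n≡m; [m+n]%n≡m%n; n%n≡0)
open import Data.Nat.GeneralisedArithmetic using (fold; fold-+)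
open import Data.Nat.Properties as ℕₚ
  using (anyUpTo?; +-comm; +-suc; +-identityʳ; +-cancelˡ-≡; m≤m+n; <-irrefl; ≤⇒≯)
open import Data.Product using (Σ; ∃; _×_; _,_; proj₁; proj₂)
open import Data.Sum using (_⊎_; inj₁; inj₂; [_,_]; map₂)
open import Data.Sum.Properties using (inj₁-injective; inj₂-injective)
open import Function using (_∘_; _on_; _⇔_; mk⇔; Equivalence; Injection; _↔_; Inverse)
open import Function.Definitions using (Injective)
open import Function.Properties.Inverse using (↔⇒↣)
open import Level using (0ℓ)
open import Relation.Binary using (Rel; IsStrictTotalOrder; tri<; tri≈; tri>; Trichotomous; DecidableEquality)
import Relation.Binary.Construct.Flip.EqAndOrd as Flip
import Relation.Binary.Structures.Biased as Biased
open import Relation.Binary.PropositionalEquality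
  using (_≡_; _≢_; refl; sym; trans; cong; cong₂; subst; subst₂; isEquivalence; module ≡-Reasoning)
open import Relation.Nullary using (¬_; Dec; yes; no; does; contradiction; _×-dec_; _⊎-dec_; ¬?)
open import Relation.Nullary.Decidable using (decidable-stable; dec-true; dec-false)
open import Relation.Unary using (Pred; Decidable; Empty; ∁; _⊆_; _≐_)

-- Since G_M is a cycle, the non-zero cells form a cyclic sequence in which consecutive cells
-- share a line, and an arc of D_π either stays inside a cell, following the cell order, or
-- joins two consecutive cells along their common line.  Indivisibility gives every point an
-- out-arc; for the last point of a cell this arc must leave the cell, so after possibly
-- reversing the cycle some cell feeds the next one (a point of the next cell lies above all
-- of it on their common line), and then every cell feeds the next.  For the coil started at
-- the last point z of a cell a, v_(j+1) is then the first point of the j-th cell after a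
-- lying above v_j on their common line, and B_(j+1) consists of the points of that cell from
-- v_(j+1) on (without z when j = ℓ).  If v_1, ..., v_ℓ are last points of their cells we get
-- (a).  Otherwise let j be the largest index for which v_j is not: if j < ℓ, the last point
-- of its cell also points to v_(j+1), which is (c); if j = ℓ, the first point of cell a above
-- the last point of the cell before a lies in B_(ℓ+1), which gives (c) or (b), unless it is
-- z.  This exception is avoided by starting right after a cell whose last point is not
-- followed by the last point of the next cell; if there is no such cell, (a) holds for every
-- start.

∃≢ : ∀ {n} → 2 ≤ n → (x : Fin n) → ∃ λ y → y ≢ x
∃≢ (s≤s (s≤s _)) x = punchIn x fzero , Finₚ.punchInᵢ≢i x fzero

module _ {n} {_<_ : Rel (Fin n) 0ℓ} (sto : IsStrictTotalOrder _≡_ _<_)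
         {Q : Pred (Fin n) 0ℓ} (Q? : Decidable Q) where
  open IsStrictTotalOrder sto using (compare) renaming (trans to <-trans)

  IsLeast : Fin n → Set
  IsLeast x = Q x × ∀ {y} → Q y → y ≢ x → x < y

  leastIn : (xs : List (Fin n)) →
            (∃ λ x → Q x × All (λ y → Q y → y ≢ x → x < y) xs) ⊎ All (∁ Q) xs
  leastIn [] = inj₂ []
  leastIn (y ∷ ys) with Q? y | leastIn ys
  ... | no ¬qy | inj₂ none             = inj₂ (¬qy ∷ none)
  ... | no ¬qy | inj₁ (x , qx , above) = inj₁ (x , qx , (λ qy → contradiction qy ¬qy) ∷ above)
  ... | yes qy | inj₂ none             =
    inj₁ (y , qy , (λ _ y≢y → contradiction refl y≢y) ∷ All.map (λ ¬qw qw → contradiction qw ¬qw) none)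
  ... | yes qy | inj₁ (x , qx , above) with compare x y
  ...   | tri< x<y _ _  = inj₁ (x , qx , (λ _ _ → x<y) ∷ above)
  ...   | tri≈ _ refl _ = inj₁ (x , qx , (λ _ y≢y → contradiction refl y≢y) ∷ above)
  ...   | tri> _ _ y<x  = inj₁ (y , qy , (λ _ y≢y → contradiction refl y≢y) ∷ All.map above-y above)
    where
    above-y : ∀ {w} → (Q w → w ≢ x → x < w) → Q w → w ≢ y → y < w
    above-y {w} x<w qw _ with compare w x
    ... | tri≈ _ refl _ = y<x
    ... | tri< _ w≢x _  = <-trans y<x (x<w qw w≢x)
    ... | tri> _ w≢x _  = <-trans y<x (x<w qw w≢x)

  least : ∃ IsLeast ⊎ Empty Q
  least with leastIn (allFin n)
  ... | inj₁ (x , qx , above) = inj₁ (x , qx , λ {y} → All.lookup above (∈-allFin y))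
  ... | inj₂ none             = inj₂ (λ y → All.lookup none (∈-allFin y))

≤-all⊎recovers⊎fails : ∀ {P : Pred ℕ 0ℓ} → Decidable P → ∀ n →
                       (∀ {j} → j ≤ n → P j) ⊎ (∃ λ j → j < n × ¬ P j × P (suc j)) ⊎ ¬ P n
≤-all⊎recovers⊎fails P? n with P? n
≤-all⊎recovers⊎fails P? n       | no ¬pn = inj₂ (inj₂ ¬pn)
≤-all⊎recovers⊎fails P? zero    | yes p0 = inj₁ λ { z≤n → p0 }
≤-all⊎recovers⊎fails P? (suc n) | yes pn+1 with ≤-all⊎recovers⊎fails P? n
... | inj₁ all-p =
  inj₁ λ j≤n+1 → [ all-p ∘ ℕₚ.≤-pred , (λ { refl → pn+1 }) ] (ℕₚ.m≤n⇒m<n∨m≡n j≤n+1)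
... | inj₂ (inj₁ (j , j<n , ¬pj , pj+1)) = inj₂ (inj₁ (j , ℕₚ.m<n⇒m<1+n j<n , ¬pj , pj+1))
... | inj₂ (inj₂ ¬pn) = inj₂ (inj₁ (n , ℕₚ.n<1+n n , ¬pn , pn+1))

isStrictTotalOrder-on : ∀ {A B : Set} {_<_ : Rel B 0ℓ} (f : A → B) → Injective _≡_ _≡_ f →
                        IsStrictTotalOrder _≡_ _<_ → IsStrictTotalOrder _≡_ (_<_ on f)
isStrictTotalOrder-on {_<_ = _<_} f f-injective sto = Biased.isStrictTotalOrderᶜ record
  { isEquivalence = isEquivalence
  ; trans         = <-trans
  ; compare       = compare-on
  }
  where
  open IsStrictTotalOrder sto using (compare) renaming (trans to <-trans)
  compare-on : Trichotomous _≡_ (_<_ on f)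
  compare-on x y with compare (f x) (f y)
  ... | tri< a ¬b ¬c = tri< a (¬b ∘ cong f) ¬c
  ... | tri≈ ¬a b ¬c = tri≈ ¬a (f-injective b) ¬c
  ... | tri> ¬a ¬b c = tri> ¬a (¬b ∘ cong f) c

fold-shift : ∀ {A : Set} (z : A) (s : A → A) n → fold (s z) s n ≡ s (fold z s n)
fold-shift z s n = trans (sym (fold-+ z s n)) (cong (fold z s) (+-comm n 1))

[m+d]%n≢m : ∀ {m d n} .{{_ : NonZero n}} → 0 < d → d < n → (m + d) % n ≢ m
[m+d]%n≢m {m} {d} {n} 0<d d<n eq = not-multiple ((m + d) / n) d≡q*n
  where
  open ≡-Reasoning
  d≡q*n : d ≡ ((m + d) / n) * n
  d≡q*n = +-cancelˡ-≡ m d _ (begin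
    m + d                         ≡⟨ m≡m%n+[m/n]*n (m + d) n ⟩
    (m + d) % n + (m + d) / n * n ≡⟨ cong (_+ (m + d) / n * n) eq ⟩
    m + (m + d) / n * n           ∎)
  not-multiple : ∀ q → d ≢ q * n
  not-multiple zero    refl = <-irrefl refl 0<d
  not-multiple (suc q) refl = ≤⇒≯ (m≤m+n n (q * n)) d<n

record Cycle (ℓ : ℕ) : Set₁ where
  field
    Carrier   : Set
    _≟_       : DecidableEquality Carrier
    next prev : Carrier → Carrier
    prev-next : ∀ k → prev (next k) ≡ k
    next-prev : ∀ k → next (prev k) ≡ k

  next-injective : ∀ {j k} → next j ≡ next k → j ≡ k
  next-injective {j} {k} eq = trans (sym (prev-next j)) (trans (cong prev eq) (prev-next k))

  infixl 6 _⊕_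
  _⊕_ : Carrier → ℕ → Carrier
  k ⊕ j = fold k next j

  field
    ⊕-period    : ∀ k → k ⊕ ℓ ≡ k
    ⊕-aperiodic : ∀ k {d} → 0 < d → d < ℓ → k ⊕ d ≢ k

  ⊕-injective : ∀ k {i j} → i < j → j ∸ i < ℓ → k ⊕ i ≢ k ⊕ j
  ⊕-injective k {i} {j} i<j j∸i<ℓ eq = ⊕-aperiodic (k ⊕ i) (ℕₚ.m<n⇒0<n∸m i<j) j∸i<ℓ (begin
    k ⊕ i ⊕ (j ∸ i) ≡⟨ fold-+ k next (j ∸ i) ⟨
    k ⊕ (j ∸ i + i) ≡⟨ cong (k ⊕_) (ℕₚ.m∸n+n≡m (ℕₚ.<⇒≤ i<j)) ⟩
    k ⊕ j           ≡⟨ eq ⟨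
    k ⊕ i           ∎)
    where open ≡-Reasoning

reverse : ∀ {ℓ} → Cycle ℓ → Cycle ℓ
reverse {ℓ} Γ = record
  { Carrier     = Carrier
  ; _≟_         = _≟_
  ; next        = prev
  ; prev        = next
  ; prev-next   = next-prev
  ; next-prev   = prev-next
  ; ⊕-period    = period
  ; ⊕-aperiodic = aperiodic
  }
  where
  open Cycle Γ
  ⊕-cancels-prev : ∀ k j → fold k prev j ⊕ j ≡ k
  ⊕-cancels-prev k zero    = refl
  ⊕-cancels-prev k (suc j) = begin
    prev (fold k prev j) ⊕ suc j    ≡⟨ fold-shift (prev (fold k prev j)) next j ⟨
    next (prev (fold k prev j)) ⊕ j ≡⟨ cong (_⊕ j) (next-prev (fold k prev j)) ⟩
    fold k prev j ⊕ j               ≡⟨ ⊕-cancels-prev k j ⟩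
    k                               ∎
    where open ≡-Reasoning
  period : ∀ k → fold k prev ℓ ≡ k
  period k = trans (sym (⊕-period (fold k prev ℓ))) (⊕-cancels-prev k ℓ)
  aperiodic : ∀ k {d} → 0 < d → d < ℓ → fold k prev d ≢ k
  aperiodic k {d} 0<d d<ℓ eq = ⊕-aperiodic k 0<d d<ℓ (trans (cong (_⊕ d) (sym eq)) (⊕-cancels-prev k d))

module Rotation (k : ℕ) where
  next : Fin (suc k) → Fin (suc k)
  next x = fromℕ< (m%n<n (suc (toℕ x)) (suc k))

  toℕ-fold-next : ∀ x j → toℕ (fold x next j) ≡ (toℕ x + j) % suc k
  toℕ-fold-next x zero = begin
    toℕ x               ≡⟨ m<n⇒m%n≡m (Finₚ.toℕ<n x) ⟨
    toℕ x % suc k       ≡⟨ cong (_% suc k) (+-identityʳ (toℕ x)) ⟨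
    (toℕ x + 0) % suc k ∎
    where open ≡-Reasoning
  toℕ-fold-next x (suc j) = begin
    toℕ (next (fold x next j))                        ≡⟨ Finₚ.toℕ-fromℕ< _ ⟩
    suc (toℕ (fold x next j)) % suc k                 ≡⟨ cong (λ t → suc t % suc k) (toℕ-fold-next x j) ⟩
    (1 + (toℕ x + j) % suc k) % suc k                 ≡⟨ %-distribˡ-+ 1 ((toℕ x + j) % suc k) (suc k) ⟩
    (1 % suc k + (toℕ x + j) % suc k % suc k) % suc k ≡⟨ cong (λ t → (1 % suc k + t) % suc k)
                                                              (m%n%n≡m%n (toℕ x + j) (suc k)) ⟩
    (1 % suc k + (toℕ x + j) % suc k) % suc k         ≡⟨ %-distribˡ-+ 1 (toℕ x + j) (suc k) ⟨
    suc (toℕ x + j) % suc k                           ≡⟨ cong (_% suc k) (+-suc (toℕ x) j) ⟨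
    (toℕ x + suc j) % suc k                           ∎
    where open ≡-Reasoning

  period : ∀ x → fold x next (suc k) ≡ x
  period x = Finₚ.toℕ-injective (begin
    toℕ (fold x next (suc k)) ≡⟨ toℕ-fold-next x (suc k) ⟩
    (toℕ x + suc k) % suc k   ≡⟨ [m+n]%n≡m%n (toℕ x) (suc k) ⟩
    toℕ x % suc k             ≡⟨ m<n⇒m%n≡m (Finₚ.toℕ<n x) ⟩
    toℕ x                     ∎)
    where open ≡-Reasoning

  cycle : Cycle (suc k)
  cycle = record
    { Carrier     = Fin (suc k)
    ; _≟_         = Finₚ._≟_
    ; next        = next
    ; prev        = λ x → fold x next k
    ; prev-next   = λ x → trans (fold-shift x next k) (period x)
    ; next-prev   = period
    ; ⊕-period    = period
    ; ⊕-aperiodic = λ x {d} 0<d d<k+1 eq →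
        [m+d]%n≢m 0<d d<k+1 (trans (sym (toℕ-fold-next x d)) (cong toℕ eq))
    }

  cycSucc⇒next : ∀ {a b} → CycSucc (suc k) a b → b ≡ next a
  cycSucc⇒next {a} {b} (inj₁ 1+a≡b) = Finₚ.toℕ-injective (begin
    toℕ b               ≡⟨ m<n⇒m%n≡m (Finₚ.toℕ<n b) ⟨
    toℕ b % suc k       ≡⟨ cong (_% suc k) 1+a≡b ⟨
    suc (toℕ a) % suc k ≡⟨ Finₚ.toℕ-fromℕ< _ ⟨
    toℕ (next a)        ∎)
    where open ≡-Reasoning
  cycSucc⇒next {a} {b} (inj₂ (1+a≡k+1 , b≡0)) = Finₚ.toℕ-injective (begin
    toℕ b               ≡⟨ b≡0 ⟩
    0                   ≡⟨ n%n≡0 (suc k) ⟨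
    suc k % suc k       ≡⟨ cong (_% suc k) 1+a≡k+1 ⟨
    suc (toℕ a) % suc k ≡⟨ Finₚ.toℕ-fromℕ< _ ⟨
    toℕ (next a)        ∎)
    where open ≡-Reasoning

Point : ∀ {m n} {M : GridMatrix m n} → Gridded M → Set
Point g = Fin (Gridded.N g)

-- The non-zero cells are indexed by the cycle: cell k lies on the lines "prev k" and "k",
-- where line k is the one shared by the cells k and next k, and x ≺[ k ] y is the
-- orientation order of line k.
record Frame {m n} (P : PMM m n) (g : Gridded (PMM.M P)) {ℓ} (Γ : Cycle ℓ) : Set₁ where
  open Cycle Γ
  field
    cell                 : Point g → Carrier
    _≺[_]_               : Point g → Carrier → Point g → Set
    ≺-isStrictTotalOrder : ∀ k → IsStrictTotalOrder _≡_ (_≺[ k ]_)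

  OnLine : Carrier → Point g → Set
  OnLine k x = cell x ≡ k ⊎ cell x ≡ next k

  field
    arc⇒line       : ∀ {x y} → Arc P g x y → ∃ λ k → OnLine k x × OnLine k y × x ≺[ k ] y
    line⇒arc       : ∀ {k x y} → OnLine k x → OnLine k y → x ≺[ k ] y → Arc P g x y
    sameCell⇒≡     : ∀ {x y} → SameCell P g x y → cell x ≡ cell y
    ≺⇔cellPrec     : ∀ {k x y} → cell x ≡ k → cell y ≡ k → x ≺[ k ] y ⇔ CellPrec P g x y
    ≺prev⇔cellPrec : ∀ {k x y} → cell x ≡ k → cell y ≡ k → x ≺[ prev k ] y ⇔ CellPrec P g x y
    out-arc        : ∀ x → ∃ (Arc P g x)

reverseFrame : ∀ {m n} {P : PMM m n} {g : Gridded (PMM.M P)} {ℓ} {Γ : Cycle ℓ} →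
               Frame P g Γ → Frame P g (reverse Γ)
reverseFrame {P = P} {g} {Γ = Γ} F = record
  { cell                 = cell
  ; _≺[_]_               = λ x k y → x ≺[ prev k ] y
  ; ≺-isStrictTotalOrder = ≺-isStrictTotalOrder ∘ prev
  ; arc⇒line             = arc⇒reversed-line
  ; line⇒arc             = λ ox oy → line⇒arc (onPrevLine ox) (onPrevLine oy)
  ; sameCell⇒≡           = sameCell⇒≡
  ; ≺⇔cellPrec           = ≺prev⇔cellPrec
  ; ≺prev⇔cellPrec       = λ {k} {x} {y} cx cy →
      subst (λ j → x ≺[ j ] y ⇔ CellPrec P g x y) (sym (prev-next k)) (≺⇔cellPrec cx cy)
  ; out-arc              = out-arc
  }
  where
  open Cycle Γ
  open Frame F
  onPrevLine : ∀ {k x} → cell x ≡ k ⊎ cell x ≡ prev k → OnLine (prev k) x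
  onPrevLine {k} (inj₁ cx) = inj₂ (trans cx (sym (next-prev k)))
  onPrevLine     (inj₂ cx) = inj₁ cx
  onLine⇒reversed : ∀ {k x} → OnLine k x → cell x ≡ next k ⊎ cell x ≡ prev (next k)
  onLine⇒reversed {k} (inj₁ cx) = inj₂ (trans cx (sym (prev-next k)))
  onLine⇒reversed     (inj₂ cx) = inj₁ cx
  arc⇒reversed-line : ∀ {x y} → Arc P g x y →
                      ∃ λ k → (cell x ≡ k ⊎ cell x ≡ prev k) × (cell y ≡ k ⊎ cell y ≡ prev k) ×
                              x ≺[ prev k ] y
  arc⇒reversed-line {x} {y} x→y with arc⇒line x→y
  ... | k , ox , oy , x≺y =
    next k , onLine⇒reversed ox , onLine⇒reversed oy , subst (λ j → x ≺[ j ] y) (sym (prev-next k)) x≺y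

module FrameProperties {m n} {P : PMM m n} {g : Gridded (PMM.M P)} {ℓ} {Γ : Cycle ℓ} (F : Frame P g Γ) where
  open Cycle Γ
  open Frame F
  open Equivalence using (to; from)
  private module ≺ k = IsStrictTotalOrder (≺-isStrictTotalOrder k)

  _≼[_]_ : Point g → Carrier → Point g → Set
  x ≼[ k ] y = x ≡ y ⊎ x ≺[ k ] y

  ≼-≺-trans : ∀ {k x y w} → x ≼[ k ] y → y ≺[ k ] w → x ≺[ k ] w
  ≼-≺-trans     (inj₁ refl) y≺w = y≺w
  ≼-≺-trans {k} (inj₂ x≺y)  y≺w = ≺.trans k x≺y y≺w

  ≺-≼-trans : ∀ {k x y w} → x ≺[ k ] y → y ≼[ k ] w → x ≺[ k ] w
  ≺-≼-trans     x≺y (inj₁ refl) = x≺y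
  ≺-≼-trans {k} x≺y (inj₂ y≺w)  = ≺.trans k x≺y y≺w

  ≺-shift : ∀ {k x y} → cell x ≡ next k → cell y ≡ next k → x ≺[ k ] y ⇔ x ≺[ next k ] y
  ≺-shift {k} {x} {y} cx cy =
    mk⇔ (from (≺⇔cellPrec cx cy) ∘ to back-line) (from back-line ∘ to (≺⇔cellPrec cx cy))
    where
    back-line : x ≺[ k ] y ⇔ CellPrec P g x y
    back-line = subst (λ j → x ≺[ j ] y ⇔ CellPrec P g x y) (prev-next k) (≺prev⇔cellPrec cx cy)

  ≺-up : ∀ {k x y} → cell x ≡ next k → cell y ≡ next k → x ≺[ k ] y → x ≺[ next k ] y
  ≺-up cx cy = to (≺-shift cx cy)

  ≺-down : ∀ {k x y} → cell x ≡ next k → cell y ≡ next k → x ≺[ next k ] y → x ≺[ k ] y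
  ≺-down cx cy = from (≺-shift cx cy)

  data ArcShape (x y : Point g) : Set where
    within   : cell y ≡ cell x → x ≺[ cell x ] y → ArcShape x y
    forward  : cell y ≡ next (cell x) → x ≺[ cell x ] y → ArcShape x y
    backward : cell x ≡ next (cell y) → x ≺[ cell y ] y → ArcShape x y

  arc-shape : ∀ {x y} → Arc P g x y → ArcShape x y
  arc-shape {x} {y} x→y with arc⇒line x→y
  ... | _ , inj₁ refl , inj₁ cy , x≺y = within cy x≺y
  ... | _ , inj₁ refl , inj₂ cy , x≺y = forward cy x≺y
  ... | _ , inj₂ cx   , inj₁ refl , x≺y = backward cx x≺y
  ... | _ , inj₂ cx   , inj₂ cy , x≺y =
    within (trans cy (sym cx)) (subst (λ j → x ≺[ j ] y) (sym cx) (≺-up cx cy x≺y))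

  IsLast : Carrier → Point g → Set
  IsLast k t = cell t ≡ k × ∀ {y} → cell y ≡ k → y ≢ t → y ≺[ k ] t

  isLast-≼ : ∀ {k t y} → IsLast k t → cell y ≡ k → y ≼[ k ] t
  isLast-≼ {y = y} (_ , below) cy with y Finₚ.≟ _
  ... | yes y≡t = inj₁ y≡t
  ... | no y≢t  = inj₂ (below cy y≢t)

  isLast-maximal : ∀ {k t y} → IsLast k t → cell y ≡ k → ¬ t ≺[ k ] y
  isLast-maximal {k} last cy t≺y = ≺.irrefl k refl (≺-≼-trans t≺y (isLast-≼ last cy))

  isLast⇒isLastOfCell : ∀ {k t} → IsLast k t → IsLastOfCell P g t
  isLast⇒isLastOfCell {k} (ct , below) y y~t y≢t = to (≺⇔cellPrec cy ct) (below cy y≢t)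
    where
    cy : cell y ≡ k
    cy = trans (sameCell⇒≡ y~t) ct

  last-arc : ∀ {k t y} → IsLast k t → Arc P g t y →
             (cell y ≡ next k × t ≺[ k ] y) ⊎ (k ≡ next (cell y) × t ≺[ cell y ] y)
  last-arc last@(refl , _) t→y with arc-shape t→y
  ... | within cy t≺y   = contradiction t≺y (isLast-maximal last cy)
  ... | forward cy t≺y  = inj₁ (cy , t≺y)
  ... | backward ct t≺y = inj₂ (ct , t≺y)

  Feeds : Carrier → Set
  Feeds k = ∃ λ w → cell w ≡ next k × ∀ {x} → cell x ≡ k → x ≺[ k ] w

  isLast⇒feeds : ∀ {k t y} → IsLast k t → cell y ≡ next k → t ≺[ k ] y → Feeds k
  isLast⇒feeds {y = y} last cy t≺y = y , cy , λ cx → ≼-≺-trans (isLast-≼ last cx) t≺y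

  IsSucc : Carrier → Point g → Point g → Set
  IsSucc k v w = cell w ≡ next k × v ≺[ k ] w ×
                 ∀ {w′} → cell w′ ≡ next k → v ≺[ k ] w′ → w′ ≢ w → w ≺[ k ] w′

  isSucc-≼ : ∀ {k v w w′} → IsSucc k v w → cell w′ ≡ next k → v ≺[ k ] w′ → w ≼[ k ] w′
  isSucc-≼ {w′ = w′} (_ , _ , first) cw′ v≺w′ with w′ Finₚ.≟ _
  ... | yes w′≡w = inj₁ (sym w′≡w)
  ... | no w′≢w  = inj₂ (first cw′ v≺w′ w′≢w)

  -- succ v is v itself when no point of the next cell lies above v.
  succ : Point g → Point g
  succ v with least (≺-isStrictTotalOrder (cell v))
                    (λ w → (cell w ≟ next (cell v)) ×-dec ≺._<?_ (cell v) v w)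
  ... | inj₁ (w , _) = w
  ... | inj₂ _       = v

  succ-isSucc : ∀ {k v} → cell v ≡ k → Feeds k → IsSucc k v (succ v)
  succ-isSucc {v = v} refl (w , cw , above)
    with least (≺-isStrictTotalOrder (cell v))
               (λ w → (cell w ≟ next (cell v)) ×-dec ≺._<?_ (cell v) v w)
  ... | inj₁ (s , (cs , v≺s) , first) = cs , v≺s , λ cw′ v≺w′ → first (cw′ , v≺w′)
  ... | inj₂ none                     = contradiction (cw , above refl) (none w)

  -- x₀ is only the value of last on an empty cell.
  module Pointed (x₀ : Point g) where

    last : Carrier → Point g
    last k with least (Flip.isStrictTotalOrder (≺-isStrictTotalOrder k)) (λ y → cell y ≟ k)
    ... | inj₁ (t , _) = t
    ... | inj₂ _       = x₀

    last-isLast : ∀ {k x} → cell x ≡ k → IsLast k (last k)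
    last-isLast {k} cx with least (Flip.isStrictTotalOrder (≺-isStrictTotalOrder k)) (λ y → cell y ≟ k)
    ... | inj₁ (t , ct , below) = ct , below
    ... | inj₂ none             = contradiction cx (none _)

    feeds⇒below-last : ∀ {k x} → Feeds k → cell x ≡ k → x ≺[ k ] last (next k)
    feeds⇒below-last {k} (w , cw , above) cx =
      ≺-≼-trans (above cx) (map₂ (≺-down cw ct) (isLast-≼ (last-isLast cw) cw))
      where
      ct : cell (last (next k)) ≡ next k
      ct = proj₁ (last-isLast cw)

    -- The out-arc of the last point of the next cell can neither stay in that cell nor go
    -- back to cell k, which lies entirely below it.
    feeds-next : ∀ {k} → Feeds k → Feeds (next k)
    feeds-next {k} feeds@(_ , cw , _) with out-arc (last (next k))
    ... | y , t→y with last-arc (last-isLast cw) t→y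
    ...   | inj₁ (cy , t≺y) = isLast⇒feeds (last-isLast cw) cy t≺y
    ...   | inj₂ (k+1≡y+1 , t≺y) =
      ⊥-elim (≺.asym k (subst (λ j → last (next k) ≺[ j ] y) cy t≺y) (feeds⇒below-last feeds cy))
      where
      cy : cell y ≡ k
      cy = next-injective (sym k+1≡y+1)

    feeds-⊕ : ∀ {k} → Feeds k → ∀ j → Feeds (k ⊕ j)
    feeds-⊕ feeds zero    = feeds
    feeds-⊕ feeds (suc j) = feeds-next (feeds-⊕ feeds j)

    succ-of-later : ∀ {k v v′} → cell v ≡ k → cell v′ ≡ k → Feeds k → v ≺[ k ] v′ →
                    succ v ≡ last (next k) → succ v′ ≡ last (next k)
    succ-of-later {k} {v} {v′} cv cv′ feeds v≺v′ sv≡t with succ-isSucc cv′ feeds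
    ... | cs′ , v′≺s′ , _ with isSucc-≼ (succ-isSucc cv feeds) cs′ (≺.trans k v≺v′ v′≺s′)
    ...   | inj₁ sv≡sv′ = trans (sym sv≡sv′) sv≡t
    ...   | inj₂ sv≺sv′ =
      contradiction (≺-up (proj₁ (last-isLast cs′)) cs′ t≺sv′) (isLast-maximal (last-isLast cs′) cs′)
      where
      t≺sv′ : last (next k) ≺[ k ] succ v′
      t≺sv′ = subst (λ t → t ≺[ k ] succ v′) sv≡t sv≺sv′

module _ {m n} (P : PMM m n) (g : Gridded (PMM.M P)) where

  FirstBoxesSingleton : Point g → ℕ → Set
  FirstBoxesSingleton z ℓ = ∀ i → 1 ≤ i → i ≤ ℓ → BoxSingleton P g z i

  ArcToNextFirst : Point g → ℕ → Set
  ArcToNextFirst z ℓ = ∃ λ i → 1 ≤ i × i ≤ ℓ ×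
    ∃ λ x → ∃ λ vi → ∃ λ vi+1 →
      IsFirstOfBox P g z i vi × IsFirstOfBox P g z (suc i) vi+1 ×
      Box P g z i x × x ≢ vi × Arc P g x vi+1

  CoilAlternatives : Point g → ℕ → Set
  CoilAlternatives z ℓ = FirstBoxesSingleton z ℓ ⊎ BoxAtLeastTwo P g z (suc ℓ) ⊎ ArcToNextFirst z ℓ

-- c j is the point v_(j+1), and InBox j describes its box B_(j+1) = Box z (suc j).
module Coil {m n} {P : PMM m n} {g : Gridded (PMM.M P)} {ℓ′} {Γ : Cycle (suc ℓ′)}
             (F : Frame P g Γ) (x₀ : Point g) (a : Cycle.Carrier Γ) (feeds-a : FrameProperties.Feeds F a) where
  open Cycle Γ
  open Frame F
  open FrameProperties F
  open FrameProperties.Pointed F x₀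
  open Equivalence using (to)
  private module ≺ k = IsStrictTotalOrder (≺-isStrictTotalOrder k)

  ℓ : ℕ
  ℓ = suc ℓ′

  κ : ℕ → Carrier
  κ j = a ⊕ j

  z : Point g
  z = last a

  c : ℕ → Point g
  c zero    = z
  c (suc j) = succ (c j)

  feeds-κ : ∀ j → Feeds (κ j)
  feeds-κ = feeds-⊕ feeds-a

  κ-period : κ ℓ ≡ a
  κ-period = ⊕-period a

  last-κ : ∀ j → IsLast (κ j) (last (κ j))
  last-κ zero    = last-isLast (trans (proj₁ (proj₂ (feeds-κ ℓ′))) κ-period)
  last-κ (suc j) = last-isLast (proj₁ (proj₂ (feeds-κ j)))

  cell-c   : ∀ j → cell (c j) ≡ κ j
  c-isSucc : ∀ j → IsSucc (κ j) (c j) (c (suc j))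
  cell-c zero    = proj₁ (last-κ 0)
  cell-c (suc j) = proj₁ (c-isSucc j)
  c-isSucc j = succ-isSucc (cell-c j) (feeds-κ j)

  c≺c : ∀ j → c j ≺[ κ j ] c (suc j)
  c≺c j = proj₁ (proj₂ (c-isSucc j))

  Tail : ℕ → Point g → Set
  Tail j x = cell x ≡ κ j × c j ≼[ κ j ] x

  InBox : ℕ → Point g → Set
  InBox zero    x = x ≡ z
  InBox (suc j) x = Tail (suc j) x × x ≢ z

  InBoxUpto : ℕ → Point g → Set
  InBoxUpto j x = ∃ λ i → i ≤ j × InBox i x

  inBox⇒tail : ∀ {j x} → InBox j x → Tail j x
  inBox⇒tail {zero}  refl = cell-c 0 , inj₁ refl
  inBox⇒tail {suc j}      = proj₁

  tail₀ : ∀ {x} → Tail 0 x → x ≡ z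
  tail₀ (_  , inj₁ z≡x) = sym z≡x
  tail₀ (cx , inj₂ z≺x) = contradiction z≺x (isLast-maximal (last-κ 0) cx)

  tail⇒inBoxUpto : ∀ {j x} → Tail j x → InBoxUpto j x
  tail⇒inBoxUpto {zero}      t = 0 , z≤n , tail₀ t
  tail⇒inBoxUpto {suc j} {x} t with x Finₚ.≟ z
  ... | yes x≡z = 0 , z≤n , x≡z
  ... | no x≢z  = suc j , ℕₚ.≤-refl , t , x≢z

  tail⇒inBox : ∀ {j x} → j < ℓ → Tail j x → InBox j x
  tail⇒inBox {zero}  _   t = tail₀ t
  tail⇒inBox {suc j} j<ℓ t@(cx , _) =
    t , λ { refl → ⊕-injective a (s≤s z≤n) j<ℓ (trans (sym (cell-c 0)) cx) }

  c-inBox : ∀ {j} → j < ℓ → InBox j (c j)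
  c-inBox {j} j<ℓ = tail⇒inBox j<ℓ (cell-c j , inj₁ refl)

  arc-from-inBox : ∀ {j u x} → InBox j u → Arc P g u x → InBoxUpto j x ⊎ Tail (suc j) x
  arc-from-inBox {j} {u} {x} bu u→x with inBox⇒tail bu | arc-shape u→x
  ... | cu , c≼u | within x~u u≺x =
    inj₁ (tail⇒inBoxUpto (trans x~u cu , inj₂ (≼-≺-trans c≼u (subst (λ k → u ≺[ k ] x) cu u≺x))))
  ... | cu , c≼u | forward x+1 u≺x = inj₂ (cx , map₂ (≺-up (cell-c (suc j)) cx) c′≼x)
    where
    cx : cell x ≡ κ (suc j)
    cx = trans x+1 (cong next cu)
    c′≼x : c (suc j) ≼[ κ j ] x
    c′≼x = isSucc-≼ (c-isSucc j) cx (≼-≺-trans c≼u (subst (λ k → u ≺[ k ] x) cu u≺x))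
  arc-from-inBox {zero} {x = x} refl _ | cu , _ | backward u+1 u≺x =
    ⊥-elim (≺.asym (κ ℓ′) (subst (λ k → z ≺[ k ] x) cx u≺x)
      (subst (λ t → x ≺[ κ ℓ′ ] t) (cong last κ-period) (feeds⇒below-last (feeds-κ ℓ′) cx)))
    where
    cx : cell x ≡ κ ℓ′
    cx = next-injective (trans (sym u+1) (trans cu (sym κ-period)))
  arc-from-inBox {suc j} {u} {x} _ _ | cu , c≼u | backward u+1 u≺x =
    inj₁ (earlier (tail⇒inBoxUpto (cx , inj₂ (≺.trans (κ j) (c≺c j) (≼-≺-trans c≼u′ u≺x′)))))
    where
    cx : cell x ≡ κ j
    cx = next-injective (trans (sym u+1) cu)
    u≺x′ : u ≺[ κ j ] x
    u≺x′ = subst (λ k → u ≺[ k ] x) cx u≺x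
    c≼u′ : c (suc j) ≼[ κ j ] u
    c≼u′ = map₂ (≺-down (cell-c (suc j)) cu) c≼u
    earlier : ∀ {y} → InBoxUpto j y → InBoxUpto (suc j) y
    earlier (i , i≤j , b) = i , ℕₚ.m≤n⇒m≤1+n i≤j , b

  inBox-fresh : ∀ {j x} → j < ℓ → InBox (suc j) x → ¬ InBoxUpto j x
  inBox-fresh _   (_ , x≢z) (zero , _ , x≡z) = x≢z x≡z
  inBox-fresh {j} j<ℓ ((cx , _) , _) (suc i , i<j , (cx′ , _) , _) =
    ⊕-injective a (s≤s i<j) (ℕₚ.≤-<-trans (ℕₚ.m∸n≤m j i) j<ℓ) (trans (sym cx′) cx)

  tail⇒arc-from-c : ∀ {j x} → Tail (suc j) x → Arc P g (c j) x
  tail⇒arc-from-c {j} (cx , c′≼x) =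
    line⇒arc (inj₁ (cell-c j)) (inj₂ cx) (≺-≼-trans (c≺c j) (map₂ (≺-down (cell-c (suc j)) cx) c′≼x))

  BoxesMatch : ℕ → Set
  BoxesMatch j = (Box P g z (suc j) ≐ InBox j) × (Upto P g z (suc j) ≐ InBoxUpto j)

  boxesMatch-step : ∀ {j} → j < ℓ → BoxesMatch j → BoxesMatch (suc j)
  boxesMatch-step {j} j<ℓ ((box⊆ , box⊇) , (upto⊆ , upto⊇)) = (box′⊆ , box′⊇) , (upto′⊆ , upto′⊇)
    where
    box′⊆ : Box P g z (suc (suc j)) ⊆ InBox (suc j)
    box′⊆ (¬old , u , bu , u→x) with arc-from-inBox (box⊆ bu) u→x
    ... | inj₁ old = contradiction (upto⊇ old) ¬old
    ... | inj₂ t   = t , λ x≡z → ¬old (upto⊇ (0 , z≤n , x≡z))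
    box′⊇ : InBox (suc j) ⊆ Box P g z (suc (suc j))
    box′⊇ b = (λ old → inBox-fresh j<ℓ b (upto⊆ old)) ,
              c j , box⊇ (c-inBox {j} j<ℓ) , tail⇒arc-from-c {j} (proj₁ b)
    upto′⊆ : Upto P g z (suc (suc j)) ⊆ InBoxUpto (suc j)
    upto′⊆ (inj₁ old) with upto⊆ old
    ... | i , i≤j , b = i , ℕₚ.m≤n⇒m≤1+n i≤j , b
    upto′⊆ (inj₂ new) = suc j , ℕₚ.≤-refl , box′⊆ new
    upto′⊇ : InBoxUpto (suc j) ⊆ Upto P g z (suc (suc j))
    upto′⊇ (i , i≤j+1 , b) with ℕₚ.m≤n⇒m<n∨m≡n i≤j+1
    ... | inj₁ i<j+1 = inj₁ (upto⊇ (i , ℕₚ.≤-pred i<j+1 , b))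
    ... | inj₂ refl  = inj₂ (box′⊇ b)

  boxesMatch : ∀ {j} → j ≤ ℓ → BoxesMatch j
  boxesMatch {zero}  _   = ((λ b → b) , (λ b → b)) , (upto⊆ , upto⊇)
    where
    upto⊆ : Upto P g z 1 ⊆ InBoxUpto 0
    upto⊆ (inj₂ x≡z) = 0 , z≤n , x≡z
    upto⊇ : InBoxUpto 0 ⊆ Upto P g z 1
    upto⊇ (zero , _ , x≡z) = inj₂ x≡z
  boxesMatch {suc j} j<ℓ = boxesMatch-step j<ℓ (boxesMatch (ℕₚ.<⇒≤ j<ℓ))

  inBox⇒above-c : ∀ {j w} → InBox j w → w ≢ c j → CellPrec P g (c j) w
  inBox⇒above-c {zero}  w≡z                    w≢c = contradiction w≡z w≢c
  inBox⇒above-c {suc j} ((_  , inj₁ c≡w) , _) w≢c = contradiction (sym c≡w) w≢c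
  inBox⇒above-c {suc j} ((cw , inj₂ c≺w) , _) _   = to (≺⇔cellPrec (cell-c (suc j)) cw) c≺w

  c-isFirst : ∀ {j} → j ≤ ℓ → InBox j (c j) → IsFirstOfBox P g z (suc j) (c j)
  c-isFirst j≤ℓ bc =
    let (box⊆ , box⊇) , _ = boxesMatch j≤ℓ
    in box⊇ bc , λ _ bw w≢c → inBox⇒above-c (box⊆ bw) w≢c

  inBox-when-last : ∀ {j w} → c j ≡ last (κ j) → InBox j w → w ≡ c j
  inBox-when-last {zero}  _ w≡z                   = w≡z
  inBox-when-last {suc j} _ ((_ , inj₁ c≡w) , _) = sym c≡w
  inBox-when-last {suc j} {w} c≡t ((cw , inj₂ c≺w) , _) =
    contradiction (subst (λ t → t ≺[ κ (suc j) ] w) c≡t c≺w) (isLast-maximal (last-κ (suc j)) cw)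

  singletons : (∀ {j} → j < ℓ → c j ≡ last (κ j)) → FirstBoxesSingleton P g z ℓ
  singletons c≡t (suc j) _ j<ℓ =
    let (box⊆ , box⊇) , _ = boxesMatch (ℕₚ.<⇒≤ j<ℓ)
    in c j , box⊇ (c-inBox {j} j<ℓ) , λ _ bw → inBox-when-last (c≡t j<ℓ) (box⊆ bw)

  succ-last≡c⇒arc : ∀ {j} → j < ℓ → InBox (suc j) (c (suc j)) → c j ≢ last (κ j) →
                    succ (last (κ j)) ≡ c (suc j) → ArcToNextFirst P g z ℓ
  succ-last≡c⇒arc {j} j<ℓ b′ c≢t st≡c′ =
    suc j , s≤s z≤n , j<ℓ , t , c j , c (suc j) ,
    c-isFirst (ℕₚ.<⇒≤ j<ℓ) (c-inBox {j} j<ℓ) , c-isFirst j<ℓ b′ ,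
    proj₂ (proj₁ (boxesMatch (ℕₚ.<⇒≤ j<ℓ))) (tail⇒inBox j<ℓ (ct , inj₂ (proj₂ (last-κ j) (cell-c j) c≢t))) ,
    (λ t≡c → c≢t (sym t≡c)) ,
    line⇒arc (inj₁ ct) (inj₂ (cell-c (suc j))) (subst (λ w → t ≺[ κ j ] w) st≡c′ t≺st)
    where
    t : Point g
    t = last (κ j)
    ct : cell t ≡ κ j
    ct = proj₁ (last-κ j)
    t≺st : t ≺[ κ j ] succ t
    t≺st = proj₁ (proj₂ (succ-isSucc ct (feeds-κ j)))

  recovery⇒arc : ∀ {j} → suc j < ℓ → c j ≢ last (κ j) → c (suc j) ≡ last (κ (suc j)) →
                 ArcToNextFirst P g z ℓ
  recovery⇒arc {j} j+1<ℓ c≢t c′≡t′ =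
    succ-last≡c⇒arc (ℕₚ.<-trans (ℕₚ.n<1+n j) j+1<ℓ) (c-inBox {suc j} j+1<ℓ) c≢t
      (trans (succ-of-later (cell-c j) (proj₁ (last-κ j)) (feeds-κ j) (proj₂ (last-κ j) (cell-c j) c≢t) c′≡t′)
             (sym c′≡t′))

  final-miss⇒two⊎arc : c ℓ′ ≢ last (κ ℓ′) → succ (last (κ ℓ′)) ≢ z →
                        BoxAtLeastTwo P g z (suc ℓ) ⊎ ArcToNextFirst P g z ℓ
  final-miss⇒two⊎arc c≢t s≢z = by-position (isSucc-≼ (c-isSucc ℓ′) cs (≺.trans (κ ℓ′) c≺t t≺s))
    where
    t s : Point g
    t = last (κ ℓ′)
    s = succ t
    ct : cell t ≡ κ ℓ′
    ct = proj₁ (last-κ ℓ′)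
    cs : cell s ≡ κ ℓ
    cs = proj₁ (succ-isSucc ct (feeds-κ ℓ′))
    c≺t : c ℓ′ ≺[ κ ℓ′ ] t
    c≺t = proj₂ (last-κ ℓ′) (cell-c ℓ′) c≢t
    t≺s : t ≺[ κ ℓ′ ] s
    t≺s = proj₁ (proj₂ (succ-isSucc ct (feeds-κ ℓ′)))
    by-position : c ℓ ≼[ κ ℓ′ ] s → BoxAtLeastTwo P g z (suc ℓ) ⊎ ArcToNextFirst P g z ℓ
    by-position (inj₁ c≡s) =
      inj₂ (succ-last≡c⇒arc ℕₚ.≤-refl ((cell-c ℓ , inj₁ refl) , λ c≡z → s≢z (trans (sym c≡s) c≡z))
                            c≢t (sym c≡s))
    by-position (inj₂ c≺s) =
      inj₁ (c ℓ , s ,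
            box⊇ ((cell-c ℓ , inj₁ refl) , c≢z) , box⊇ ((cs , inj₂ (≺-up (cell-c ℓ) cs c≺s)) , s≢z) ,
            λ c≡s → ≺.irrefl (κ ℓ′) c≡s c≺s)
      where
      box⊇ : InBox ℓ ⊆ Box P g z (suc ℓ)
      box⊇ = proj₂ (proj₁ (boxesMatch {ℓ} ℕₚ.≤-refl))
      z-last : IsLast (κ ℓ) z
      z-last = subst (λ k → IsLast k z) (sym κ-period) (last-κ 0)
      c≢z : c ℓ ≢ z
      c≢z c≡z = ≺.asym (κ ℓ′) (subst (λ w → w ≺[ κ ℓ′ ] s) c≡z c≺s)
                                (≺-down cs (proj₁ z-last) (proj₂ z-last cs s≢z))

  jump⇒alternatives : succ (last (prev a)) ≢ z → CoilAlternatives P g z ℓ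
  jump⇒alternatives s≢z with ≤-all⊎recovers⊎fails (λ j → c j Finₚ.≟ last (κ j)) ℓ′
  ... | inj₁ all-last = inj₁ (singletons (all-last ∘ ℕₚ.≤-pred))
  ... | inj₂ (inj₁ (j , j<ℓ′ , c≢t , c′≡t′)) = inj₂ (inj₂ (recovery⇒arc (s≤s j<ℓ′) c≢t c′≡t′))
  ... | inj₂ (inj₂ c≢t) = inj₂ (final-miss⇒two⊎arc c≢t (subst (λ k → succ (last k) ≢ z) prev-a s≢z))
    where
    prev-a : prev a ≡ κ ℓ′
    prev-a = trans (cong prev (sym κ-period)) (prev-next (κ ℓ′))

  chained⇒c≡last : (∀ {j} → j < ℓ → succ (last (κ j)) ≡ last (κ (suc j))) →
                   ∀ {j} → j < ℓ → c j ≡ last (κ j)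
  chained⇒c≡last chained {zero}  _   = refl
  chained⇒c≡last chained {suc j} j+1<ℓ = trans (cong succ (chained⇒c≡last chained j<ℓ)) (chained j<ℓ)
    where
    j<ℓ : j < ℓ
    j<ℓ = ℕₚ.<-trans (ℕₚ.n<1+n j) j+1<ℓ

module _ {m n} {P : PMM m n} {g : Gridded (PMM.M P)} {ℓ′} {Γ : Cycle (suc ℓ′)}
         (F : Frame P g Γ) (x₀ : Point g) where
  open Cycle Γ
  open Frame F
  open FrameProperties F
  open FrameProperties.Pointed F x₀

  coil-alternatives : ∃ Feeds → Σ (Point g) λ z → IsLastOfCell P g z × CoilAlternatives P g z (suc ℓ′)
  coil-alternatives (a , feeds-a)
    with anyUpTo? (λ j → ¬? (succ (last (a ⊕ j)) Finₚ.≟ last (a ⊕ suc j))) (suc ℓ′)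
  ... | yes (j , _ , jump) =
    z , isLast⇒isLastOfCell (last-κ 0) ,
    jump⇒alternatives (subst (λ k → succ (last k) ≢ z) (sym (prev-next (a ⊕ j))) jump)
    where open Coil F x₀ (a ⊕ suc j) (feeds-⊕ feeds-a (suc j))
  ... | no no-jump =
    z , isLast⇒isLastOfCell (last-κ 0) ,
    inj₁ (singletons (chained⇒c≡last λ {j} j<ℓ →
      decidable-stable (succ (last (κ j)) Finₚ.≟ last (κ (suc j))) (λ jump → no-jump (j , j<ℓ , jump))))
    where open Coil F x₀ a feeds-a

  isLast-reverse : ∀ {k t} → IsLast k t → FrameProperties.IsLast (reverseFrame F) k t
  isLast-reverse (ct , below) =
    ct , λ cy y≢t → from (≺prev⇔cellPrec cy ct) (to (≺⇔cellPrec cy ct) (below cy y≢t))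
    where open Equivalence using (to; from)

  orientation : ∃ Feeds ⊎ ∃ (FrameProperties.Feeds (reverseFrame F))
  orientation with out-arc (last (cell x₀))
  ... | y , t→y with last-arc (last-isLast refl) t→y
  ...   | inj₁ (cy , t≺y) = inj₁ (cell x₀ , isLast⇒feeds (last-isLast refl) cy t≺y)
  ...   | inj₂ (k≡y+1 , t≺y) =
    inj₂ (cell x₀ , FrameProperties.isLast⇒feeds (reverseFrame F) (isLast-reverse (last-isLast refl)) cy
                      (subst (λ k → last (cell x₀) ≺[ k ] y) cy t≺y))
    where
    cy : cell y ≡ prev (cell x₀)
    cy = trans (sym (prev-next (cell y))) (cong prev (sym k≡y+1))

module Grid {m n} (P : PMM m n) (g : Gridded (PMM.M P)) where
  open PMM P
  open Gridded g

  Line : Set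
  Line = Fin m ⊎ Fin n

  Through : Line → Point g → Set
  Through (inj₁ i) x = col x ≡ i
  Through (inj₂ j) x = row x ≡ j

  LineOrder : Line → Point g → Point g → Set
  LineOrder (inj₁ i) = ColPrec P g i
  LineOrder (inj₂ j) = RowPrec P g j

  π-injective : Injective _≡_ _≡_ (π ⟨$⟩ʳ_)
  π-injective = Injection.injective (↔⇒↣ π)

  lineOrder-sto : ∀ v → IsStrictTotalOrder _≡_ (LineOrder v)
  lineOrder-sto (inj₁ i) with c i
  ... | plus  = Finₚ.<-isStrictTotalOrder
  ... | minus = Flip.isStrictTotalOrder Finₚ.<-isStrictTotalOrder
  lineOrder-sto (inj₂ j) with r j
  ... | plus  = isStrictTotalOrder-on (π ⟨$⟩ʳ_) π-injective Finₚ.<-isStrictTotalOrder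
  ... | minus = isStrictTotalOrder-on (π ⟨$⟩ʳ_) π-injective (Flip.isStrictTotalOrder Finₚ.<-isStrictTotalOrder)

  module LineOrder v = IsStrictTotalOrder (lineOrder-sto v)

  arc⇒through : ∀ {x y} → Arc P g x y → ∃ λ v → Through v x × Through v y × LineOrder v x y
  arc⇒through {x} (inj₁ (cx≡cy , x≺y)) = inj₁ (col x) , refl , sym cx≡cy , x≺y
  arc⇒through {x} (inj₂ (rx≡ry , x≺y)) = inj₂ (row x) , refl , sym rx≡ry , x≺y

  through⇒arc : ∀ {v x y} → Through v x → Through v y → LineOrder v x y → Arc P g x y
  through⇒arc {inj₁ _} refl cy x≺y = inj₁ (sym cy , x≺y)
  through⇒arc {inj₂ _} refl ry x≺y = inj₂ (sym ry , x≺y)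

  colPrec⇒rowPrec : ∀ {x y} → SameCell P g x y → ColPrec P g (col x) x y → RowPrec P g (row x) x y
  colPrec⇒rowPrec {x} {y} (cx≡cy , rx≡ry) x≺y with c (col x) | r (row x) | mult (col x) (row x) (nonzero x)
  ... | plus  | plus  | e = incr x y x≺y cx≡cy rx≡ry e
  ... | plus  | minus | e = decr x y x≺y cx≡cy rx≡ry e
  ... | minus | plus  | e = decr y x x≺y (sym cx≡cy) (sym rx≡ry) (subst₂ (λ i j → M i j ≡ neg) cx≡cy rx≡ry e)
  ... | minus | minus | e = incr y x x≺y (sym cx≡cy) (sym rx≡ry) (subst₂ (λ i j → M i j ≡ pos) cx≡cy rx≡ry e)

  rowPrec⇒colPrec : ∀ {x y} → SameCell P g x y → RowPrec P g (row x) x y → ColPrec P g (col x) x y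
  rowPrec⇒colPrec {x} {y} x~y@(cx≡cy , rx≡ry) x≺y with LineOrder.compare (inj₁ (col x)) x y
  ... | tri< x≺′y _ _ = x≺′y
  ... | tri≈ _ refl _ = ⊥-elim (LineOrder.irrefl (inj₂ (row x)) refl x≺y)
  ... | tri> _ _ y≺′x = ⊥-elim (LineOrder.asym (inj₂ (row x)) x≺y
          (subst (λ j → RowPrec P g j y x) (sym rx≡ry)
            (colPrec⇒rowPrec (sym cx≡cy , sym rx≡ry) (subst (λ i → ColPrec P g i y x) cx≡cy y≺′x))))

  through⇒≺⇔cellPrec : ∀ {v x y} → SameCell P g x y → Through v x → LineOrder v x y ⇔ CellPrec P g x y
  through⇒≺⇔cellPrec {inj₁ _} x~y refl = mk⇔ (x~y ,_) proj₂
  through⇒≺⇔cellPrec {inj₂ _} x~y refl =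
    mk⇔ (λ x≺y → x~y , rowPrec⇒colPrec x~y x≺y) (colPrec⇒rowPrec x~y ∘ proj₂)

  arc? : ∀ x y → Dec (Arc P g x y)
  arc? x y = ((col x Finₚ.≟ col y) ×-dec LineOrder._<?_ (inj₁ (col x)) x y)
           ⊎-dec ((row x Finₚ.≟ row y) ×-dec LineOrder._<?_ (inj₂ (row x)) x y)

  indivisible⇒out-arc : Indivisible P g → 2 ≤ N → ∀ x → ∃ (Arc P g x)
  indivisible⇒out-arc ind 2≤N x with Finₚ.any? (arc? x)
  ... | yes out = out
  ... | no sink = ⊥-elim (ind (isOther , (y , isOther-y) , (x , isOther-x) , precede))
    where
    y : Point g
    y = proj₁ (∃≢ 2≤N x)
    isOther : Point g → Bool
    isOther s = not (does (s Finₚ.≟ x))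
    isOther-x : isOther x ≡ false
    isOther-x = cong not (dec-true (x Finₚ.≟ x) refl)
    isOther-y : isOther y ≡ true
    isOther-y = cong not (dec-false (y Finₚ.≟ x) (proj₂ (∃≢ 2≤N x)))
    below-sink : ∀ {v s} → Through v s → Through v x → s ≢ x → LineOrder v s x
    below-sink {v} {s} ts tx s≢x with LineOrder.compare v s x
    ... | tri< s≺x _ _ = s≺x
    ... | tri≈ _ s≡x _ = contradiction s≡x s≢x
    ... | tri> _ _ x≺s = contradiction (s , through⇒arc tx ts x≺s) sink
    precede : ∀ s t → isOther s ≡ true → isOther t ≡ false →
              (col s ≡ col t → ColPrec P g (col s) s t) × (row s ≡ row t → RowPrec P g (row s) s t)
    precede s t other-s other-t with s Finₚ.≟ x | t Finₚ.≟ x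
    precede s t ()      _       | yes _   | _
    precede s t _       ()      | no _    | no _
    precede s t _       _       | no s≢x  | yes refl =
      (λ cs≡cx → below-sink {inj₁ (col s)} refl (sym cs≡cx) s≢x) ,
      (λ rs≡rx → below-sink {inj₂ (row s)} refl (sym rs≡rx) s≢x)

module GridFrame {m n} (P : PMM m n) (g : Gridded (PMM.M P)) {k} (f : Fin (suc k) ↔ (Fin m ⊎ Fin n))
  (adj : ∀ a b → (RCAdj (PMM.M P) (Inverse.to f a) (Inverse.to f b) → CycAdj (suc k) a b)
               × (CycAdj (suc k) a b → RCAdj (PMM.M P) (Inverse.to f a) (Inverse.to f b))) where
  open PMM P
  open Gridded g
  open Grid P g
  open Rotation k using (cycle; cycSucc⇒next)
  open Cycle cycle using (next; prev; next-prev; next-injective)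

  line : Fin (suc k) → Line
  line = Inverse.to f

  position : Line → Fin (suc k)
  position = Inverse.from f

  line-position : ∀ v → line (position v) ≡ v
  line-position v = Inverse.inverseˡ f refl

  line-injective : Injective _≡_ _≡_ line
  line-injective = Injection.injective (↔⇒↣ f)

  -- A non-zero cell (i , j) is an edge of the cycle G_M; Edge a i j says that it joins the
  -- positions a and next a.
  Edge : Fin (suc k) → Fin m → Fin n → Set
  Edge a i j = (line a ≡ inj₁ i × line (next a) ≡ inj₂ j) ⊎ (line a ≡ inj₂ j × line (next a) ≡ inj₁ i)

  edgeOf : Fin m → Fin n → Fin (suc k)
  edgeOf i j with position (inj₂ j) Finₚ.≟ next (position (inj₁ i))
  ... | yes _ = position (inj₁ i)
  ... | no _  = position (inj₂ j)

  edgeOf-edge : ∀ {i j} → M i j ≢ zer → Edge (edgeOf i j) i j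
  edgeOf-edge {i} {j} Mij≢0 with position (inj₂ j) Finₚ.≟ next (position (inj₁ i))
  ... | yes j-after-i = inj₁ (line-position _ , trans (cong line (sym j-after-i)) (line-position _))
  ... | no j-not-after-i
    with proj₁ (adj (position (inj₁ i)) (position (inj₂ j)))
                (subst₂ (RCAdj M) (sym (line-position _)) (sym (line-position _)) Mij≢0)
  ...   | inj₁ i→j = contradiction (cycSucc⇒next i→j) j-not-after-i
  ...   | inj₂ j→i = inj₂ (line-position _ , trans (cong line (sym (cycSucc⇒next j→i))) (line-position _))

  edge-determines : ∀ {a i i′ j j′} → Edge a i j → Edge a i′ j′ → i ≡ i′ × j ≡ j′
  edge-determines (inj₁ (p , q)) (inj₁ (p′ , q′)) =
    inj₁-injective (trans (sym p) p′) , inj₂-injective (trans (sym q) q′)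
  edge-determines (inj₂ (p , q)) (inj₂ (p′ , q′)) =
    inj₁-injective (trans (sym q) q′) , inj₂-injective (trans (sym p) p′)
  edge-determines (inj₁ (p , _)) (inj₂ (p′ , _)) = contradiction (trans (sym p) p′) λ ()
  edge-determines (inj₂ (p , _)) (inj₁ (p′ , _)) = contradiction (trans (sym p) p′) λ ()

  cell : Point g → Fin (suc k)
  cell x = edgeOf (col x) (row x)

  cell-edge : ∀ {x a} → cell x ≡ a → Edge a (col x) (row x)
  cell-edge {x} refl = edgeOf-edge (nonzero x)

  through-endpoints : ∀ {a x} → Edge a (col x) (row x) → Through (line a) x × Through (line (next a)) x
  through-endpoints {x = x} (inj₁ (p , q)) =
    subst (λ v → Through v x) (sym p) refl , subst (λ v → Through v x) (sym q) refl
  through-endpoints {x = x} (inj₂ (p , q)) =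
    subst (λ v → Through v x) (sym p) refl , subst (λ v → Through v x) (sym q) refl

  through⇒endpoint : ∀ {a v x} → Edge a (col x) (row x) → Through v x → v ≡ line a ⊎ v ≡ line (next a)
  through⇒endpoint {v = inj₁ _} (inj₁ (p , _)) refl = inj₁ (sym p)
  through⇒endpoint {v = inj₁ _} (inj₂ (_ , q)) refl = inj₂ (sym q)
  through⇒endpoint {v = inj₂ _} (inj₁ (_ , q)) refl = inj₂ (sym q)
  through⇒endpoint {v = inj₂ _} (inj₂ (p , _)) refl = inj₁ (sym p)

  OnLine : Fin (suc k) → Point g → Set
  OnLine a x = cell x ≡ a ⊎ cell x ≡ next a

  onLine⇒through : ∀ {a x} → OnLine a x → Through (line (next a)) x
  onLine⇒through (inj₁ cx) = proj₂ (through-endpoints (cell-edge cx))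
  onLine⇒through (inj₂ cx) = proj₁ (through-endpoints (cell-edge cx))

  through⇒onLine : ∀ {a x} → Through (line (next a)) x → OnLine a x
  through⇒onLine tx with through⇒endpoint (cell-edge refl) tx
  ... | inj₁ e = inj₂ (sym (line-injective e))
  ... | inj₂ e = inj₁ (sym (next-injective (line-injective e)))

  arc⇒onLine : ∀ {x y} → Arc P g x y → ∃ λ a → OnLine a x × OnLine a y × LineOrder (line (next a)) x y
  arc⇒onLine {x} {y} x→y with arc⇒through x→y
  ... | v , tx , ty , x≺y =
    prev (position v) , through⇒onLine (transport tx) , through⇒onLine (transport ty) ,
    subst (λ u → LineOrder u x y) (sym line≡v) x≺y
    where
    line≡v : line (next (prev (position v))) ≡ v
    line≡v = trans (cong line (next-prev (position v))) (line-position v)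
    transport : ∀ {w} → Through v w → Through (line (next (prev (position v)))) w
    transport {w} = subst (λ u → Through u w) (sym line≡v)

  frame : Indivisible P g → 2 ≤ N → Frame P g cycle
  frame ind 2≤N = record
    { cell                 = cell
    ; _≺[_]_               = λ x a y → LineOrder (line (next a)) x y
    ; ≺-isStrictTotalOrder = λ a → lineOrder-sto (line (next a))
    ; arc⇒line             = arc⇒onLine
    ; line⇒arc             = λ ox oy → through⇒arc (onLine⇒through ox) (onLine⇒through oy)
    ; sameCell⇒≡           = λ (cx≡cy , rx≡ry) → cong₂ edgeOf cx≡cy rx≡ry
    ; ≺⇔cellPrec           = λ cx cy → through⇒≺⇔cellPrec (sameCell cx cy) (onLine⇒through (inj₁ cx))
    ; ≺prev⇔cellPrec       = λ {a} cx cy →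
        through⇒≺⇔cellPrec (sameCell cx cy) (onLine⇒through (inj₂ (trans cx (sym (next-prev a)))))
    ; out-arc              = indivisible⇒out-arc ind 2≤N
    }
    where
    sameCell : ∀ {a x y} → cell x ≡ a → cell y ≡ a → SameCell P g x y
    sameCell cx cy = edge-determines (cell-edge cx) (cell-edge cy)

proposition6p2 :
  {m n : ℕ} (P : PMM m n) (ℓ : ℕ) → IsCyclicOfLength (PMM.M P) ℓ →
  (g : Gridded (PMM.M P)) → Indivisible P g → 2 ≤ Gridded.N g →
  Σ (Fin (Gridded.N g)) λ z → IsLastOfCell P g z ×
    ( (∀ i → 1 ≤ i → i ≤ ℓ → BoxSingleton P g z i)
    ⊎ BoxAtLeastTwo P g z (suc ℓ)
    ⊎ (∃ λ i → 1 ≤ i × i ≤ ℓ ×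
         ∃ λ x → ∃ λ vi → ∃ λ vi+1 →
           IsFirstOfBox P g z i vi × IsFirstOfBox P g z (suc i) vi+1 ×
           Box P g z i x × x ≢ vi × Arc P g x vi+1) )
proposition6p2 P zero (() , _) g ind 2≤N
proposition6p2 P (suc ℓ′) (_ , f , adj) g ind 2≤N =
  [ coil-alternatives F x₀ , coil-alternatives (reverseFrame F) x₀ ] (orientation F x₀)
  where
  F : Frame P g (Rotation.cycle ℓ′)
  F = GridFrame.frame P g f adj ind 2≤N
  x₀ : Point g
  x₀ = fromℕ< 2≤N
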